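{- Let $f:\mathbb{F}_2^n\to\{ -1,1\}$ be any Boolean function. Suppose there exists $\alpha\in\mathcal{S}$ such that $|O_{\alpha+\beta}|=2$ for all $\beta\in\mathcal{S}\setminus\{\alpha\}$. Then either $|\mathcal{S}_+|$ is odd or $|\mathcal{S}_-|$ is odd.
   Context: For $\alpha\in\mathbb{F}_2^n$ let $\chi_\alpha(x)=(-1)^{\sum_i\alpha_ix_i}$; every $f:\mathbb{F}_2^n\to\mathbb{R}$ is uniquely $f=\sum_\alpha\widehat f(\alpha)\chi_\alpha$. The Fourier support is $\mathcal{S}=\{\alpha:\widehat f(\alpha)\ne0\}$, $\mathcal{S}_+=\{\alpha:\widehat f(\alpha)>0\}$, $\mathcal{S}_-=\{\alpha:\widehat f(\alpha)<0\}$. For $\gamma\in\mathbb{F}_2^n$, $O_\gamma$ is the set of unordered pairs of distinct elements of $\mathcal{S}$ summing to $\gamma$. -}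

module Defs where

open import Data.Bool using (Bool; true; false; _xor_; _∧_)
import Data.Bool as B
import Data.Vec.Properties as VP
open import Data.Nat as ℕ using (ℕ; zero; suc)
open import Data.Nat.Properties using (m^n≢0)
open import Data.Integer as ℤ using (ℤ; +_)
open import Data.Rational as ℚ using (ℚ; 0ℚ; _/_)
open import Data.Rational.Properties using (_≟_; _<?_)
open import Data.Vec as Vec using (Vec; []; _∷_; zipWith; foldr)
open import Data.List as List using (List; []; _∷_; _++_; map; filter; length; concatMap)
open import Data.Product using (_×_; _,_; proj₁; proj₂)
open import Relation.Nullary using (¬?)
open import Relation.Binary.PropositionalEquality using (_≡_)

F₂^ : ℕ → Set
F₂^ n = Vec Bool n

_⊕_ : ∀ {n} → F₂^ n → F₂^ n → F₂^ n
_⊕_ = zipWith _xor_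

dot : ∀ {n} → F₂^ n → F₂^ n → Bool
dot α x = foldr (λ _ → Bool) _xor_ false (zipWith _∧_ α x)

χ : ∀ {n} → F₂^ n → F₂^ n → ℤ
χ α x with dot α x
... | false = ℤ.+ 1
... | true  = ℤ.- (ℤ.+ 1)

allVec : (n : ℕ) → List (F₂^ n)
allVec zero = [] ∷ []
allVec (suc n) = map (false ∷_) (allVec n) ++ map (true ∷_) (allVec n)

sumℤ : List ℤ → ℤ
sumℤ = List.foldr ℤ._+_ (ℤ.+ 0)

fourier : ∀ {n} → (F₂^ n → ℤ) → F₂^ n → ℚ
fourier {n} f α =
  _/_ (sumℤ (map (λ x → f x ℤ.* χ α x) (allVec n))) (2 ℕ.^ n) {{m^n≢0 2 n}}

supp : ∀ {n} → (F₂^ n → ℤ) → List (F₂^ n)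
supp {n} f = filter (λ α → ¬? (fourier f α ≟ 0ℚ)) (allVec n)

supp₊ : ∀ {n} → (F₂^ n → ℤ) → List (F₂^ n)
supp₊ {n} f = filter (λ α → 0ℚ <? fourier f α) (allVec n)

supp₋ : ∀ {n} → (F₂^ n → ℤ) → List (F₂^ n)
supp₋ {n} f = filter (λ α → fourier f α <? 0ℚ) (allVec n)

pairs : ∀ {A : Set} → List A → List (A × A)
pairs [] = []
pairs (x ∷ xs) = map (λ y → (x , y)) xs ++ pairs xs

-- O_γ: unordered pairs of distinct elements of S summing to γ.
-- (S is duplicate-free, so pairs with i < j are exactly the unordered pairs
-- of distinct elements.)
O : ∀ {n} → (F₂^ n → ℤ) → F₂^ n → List (F₂^ n × F₂^ n)
O {n} f γ = filter (λ p → VP.≡-dec B._≟_ (proj₁ p ⊕ proj₂ p) γ) (pairs (supp f))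

module Submission where

-- Write F = 2ⁿ f̂ for the integer Walsh transform of f. Since f² = 1, for every γ ≠ 0 the
-- autocorrelation Σₐ F(a) F(a + γ) vanishes; its nonzero terms sit exactly at the endpoints of
-- the pairs of O_γ, a pair {a, a + γ} contributing 2 F(a) F(a + γ). For β ∈ S ∖ {α} and
-- γ = α + β one pair of O_γ is {α, β}; the other pair {c, c + γ} must differ from it (else the
-- sum would be 4 F(α) F(β) ≠ 0), so F(c) F(c + γ) = −F(α) F(β). Hence if f̂(β) has the sign of
-- f̂(α), exactly one of c, c + γ has it too, and it is the only y ∉ {α, β} in that sign class
-- with y + γ ∈ S. This relation is symmetric in β and y, so it pairs off the sign class of
-- f̂(α) with α removed, and the sign class has odd size.

open import Defs
open import Data.Bool using (Bool; true; false; not)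
open import Data.Bool.Properties as Bool using (xor-comm; xor-assoc; xor-same; xor-identityʳ)
open import Data.Empty using (⊥-elim)
open import Data.Integer as ℤ using (ℤ; +_; -[1+_]; +[1+_]; 0ℤ; _+_; _*_; -_; _<_)
import Data.Integer.Properties as ℤ
open import Data.Integer.Tactic.RingSolver using (solve-∀)
open import Data.List as List using (List; []; _∷_; _++_; map; filter; length)
import Data.List.Properties as List
open import Data.List.Membership.Propositional using (_∈_)
open import Data.List.Membership.Propositional.Properties
  using (∈-++⁺ˡ; ∈-++⁺ʳ; ∈-map⁺; ∈-map⁻; ∈-filter⁺; ∈-filter⁻)
import Data.List.Relation.Unary.All as All
import Data.List.Relation.Unary.AllPairs as AllPairs
open import Data.List.Relation.Unary.Any as Any using (Any; here; there; tail)
open import Data.List.Relation.Unary.Unique.Propositional using (Unique)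
import Data.List.Relation.Unary.Unique.Propositional.Properties as Unique
open import Data.Nat as ℕ using (ℕ; zero; suc; _^_; _%_)
open import Data.Nat.DivMod using ([m+kn]%n≡m%n)
open import Data.Nat.Properties as ℕ using (m^n≢0)
open import Data.Product using (Σ; _×_; _,_; proj₁; proj₂; ∃-syntax)
open import Data.Rational as ℚ using (0ℚ; _/_)
import Data.Rational.Properties as ℚ
open import Data.Sum as Sum using (_⊎_; inj₁; inj₂; [_,_])
open import Data.Vec using ([]; _∷_; replicate)
open import Data.Vec.Properties as Vec using (∷-injectiveʳ; zipWith-comm; zipWith-assoc; zipWith-identityʳ)
open import Function using (_∘_; id)
open import Relation.Binary.Definitions using (DecidableEquality; tri<; tri≈; tri>)
open import Relation.Binary.PropositionalEquality
  using (_≡_; _≢_; refl; sym; trans; cong; cong₂; ≢-sym; subst; module ≡-Reasoning)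
open import Relation.Nullary using (¬_; ¬?; yes; no)

𝟎 : ∀ {n} → F₂^ n
𝟎 {n} = replicate n false

⊕-self : ∀ {n} (a : F₂^ n) → a ⊕ a ≡ 𝟎
⊕-self []      = refl
⊕-self (x ∷ a) = cong₂ _∷_ (xor-same x) (⊕-self a)

module _ {n : ℕ} where

  ⊕-comm : (a b : F₂^ n) → a ⊕ b ≡ b ⊕ a
  ⊕-comm = zipWith-comm xor-comm

  ⊕-assoc : (a b c : F₂^ n) → (a ⊕ b) ⊕ c ≡ a ⊕ (b ⊕ c)
  ⊕-assoc = zipWith-assoc xor-assoc

  ⊕-identityʳ : (a : F₂^ n) → a ⊕ 𝟎 ≡ a
  ⊕-identityʳ = zipWith-identityʳ xor-identityʳ

  ⊕-cancelʳ : (a b : F₂^ n) → (a ⊕ b) ⊕ b ≡ a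
  ⊕-cancelʳ a b = trans (⊕-assoc a b b) (trans (cong (a ⊕_) (⊕-self b)) (⊕-identityʳ a))

  ⊕-cancelˡ : (a b : F₂^ n) → a ⊕ (a ⊕ b) ≡ b
  ⊕-cancelˡ a b = trans (⊕-comm a (a ⊕ b)) (trans (cong (_⊕ a) (⊕-comm a b)) (⊕-cancelʳ b a))

  ⊕-injectiveʳ : ∀ {a b} (c : F₂^ n) → a ⊕ c ≡ b ⊕ c → a ≡ b
  ⊕-injectiveʳ {a} {b} c eq = trans (sym (⊕-cancelʳ a c)) (trans (cong (_⊕ c) eq) (⊕-cancelʳ b c))

  ⊕-swap : (x a y : F₂^ n) → x ⊕ (a ⊕ y) ≡ y ⊕ (a ⊕ x)
  ⊕-swap x a y = begin
    x ⊕ (a ⊕ y) ≡⟨ ⊕-comm x (a ⊕ y) ⟩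
    (a ⊕ y) ⊕ x ≡⟨ ⊕-assoc a y x ⟩
    a ⊕ (y ⊕ x) ≡⟨ cong (a ⊕_) (⊕-comm y x) ⟩
    a ⊕ (x ⊕ y) ≡⟨ sym (⊕-assoc a x y) ⟩
    (a ⊕ x) ⊕ y ≡⟨ ⊕-comm (a ⊕ x) y ⟩
    y ⊕ (a ⊕ x) ∎
    where open ≡-Reasoning

  ⊕≡𝟎⇒≡ : ∀ {a b : F₂^ n} → a ⊕ b ≡ 𝟎 → a ≡ b
  ⊕≡𝟎⇒≡ {a} {b} eq = ⊕-injectiveʳ b (trans eq (sym (⊕-self b)))

  a≢a⊕b : ∀ {b : F₂^ n} → b ≢ 𝟎 → ∀ a → a ≢ a ⊕ b
  a≢a⊕b {b} b≢𝟎 a eq = b≢𝟎 (trans (sym (⊕-cancelˡ a b)) (trans (cong (a ⊕_) (sym eq)) (⊕-self a)))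

sgn : Bool → ℤ
sgn false = + 1
sgn true  = - + 1

sgn-not : ∀ b → sgn (not b) ≡ - sgn b
sgn-not false = refl
sgn-not true  = refl

module _ {n : ℕ} where

  χ-∷-false : ∀ b (a x : F₂^ n) → χ (b ∷ a) (false ∷ x) ≡ χ a x
  χ-∷-false false a x = refl
  χ-∷-false true  a x = refl

  χ-∷-true : ∀ b (a x : F₂^ n) → χ (b ∷ a) (true ∷ x) ≡ sgn b * χ a x
  χ-∷-true false a x = sym (ℤ.*-identityˡ (χ a x))
  χ-∷-true true  a x with dot a x
  ... | false = refl
  ... | true  = refl

∑ : ∀ {A : Set} → List A → (A → ℤ) → ℤ
∑ xs g = sumℤ (map g xs)

infix 5 ∑
syntax ∑ xs (λ x → e) = ∑[ x ∈ xs ] e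

module _ {A : Set} where

  ∑-cong : ∀ (xs : List A) {g h : A → ℤ} → (∀ x → g x ≡ h x) → ∑ xs g ≡ ∑ xs h
  ∑-cong []       eq = refl
  ∑-cong (x ∷ xs) eq = cong₂ _+_ (eq x) (∑-cong xs eq)

  ∑-cong-∈ : ∀ (xs : List A) {g h : A → ℤ} → (∀ {x} → x ∈ xs → g x ≡ h x) → ∑ xs g ≡ ∑ xs h
  ∑-cong-∈ []       eq = refl
  ∑-cong-∈ (x ∷ xs) eq = cong₂ _+_ (eq (here refl)) (∑-cong-∈ xs (eq ∘ there))

  ∑-zero : ∀ (xs : List A) {g : A → ℤ} → (∀ x → g x ≡ 0ℤ) → ∑ xs g ≡ 0ℤ
  ∑-zero []       _  = refl
  ∑-zero (x ∷ xs) eq = cong₂ _+_ (eq x) (∑-zero xs eq)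

  ∑-++ : ∀ (xs ys : List A) (g : A → ℤ) → ∑ (xs ++ ys) g ≡ ∑ xs g + ∑ ys g
  ∑-++ []       ys g = sym (ℤ.+-identityˡ _)
  ∑-++ (x ∷ xs) ys g = trans (cong (_+_ (g x)) (∑-++ xs ys g)) (sym (ℤ.+-assoc (g x) _ _))

  ∑-+ : ∀ (xs : List A) (g h : A → ℤ) → ∑[ x ∈ xs ] (g x + h x) ≡ ∑ xs g + ∑ xs h
  ∑-+ []       g h = refl
  ∑-+ (x ∷ xs) g h = trans (cong (_+_ (g x + h x)) (∑-+ xs g h)) (interchange (g x) (h x) _ _)
    where
    interchange : ∀ a b c d → a + b + (c + d) ≡ a + c + (b + d)
    interchange = solve-∀

  ∑-*ˡ : ∀ (xs : List A) (c : ℤ) (g : A → ℤ) → ∑[ x ∈ xs ] (c * g x) ≡ c * ∑ xs g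
  ∑-*ˡ []       c g = sym (ℤ.*-zeroʳ c)
  ∑-*ˡ (x ∷ xs) c g = trans (cong (_+_ (c * g x)) (∑-*ˡ xs c g)) (sym (ℤ.*-distribˡ-+ c (g x) _))

∑-allVec-suc : ∀ n (g : F₂^ (suc n) → ℤ) →
               ∑ (allVec (suc n)) g ≡ (∑[ x ∈ allVec n ] g (false ∷ x)) + (∑[ x ∈ allVec n ] g (true ∷ x))
∑-allVec-suc n g = begin
  sumℤ (map g (map (false ∷_) V ++ map (true ∷_) V))
    ≡⟨ ∑-++ (map (false ∷_) V) (map (true ∷_) V) g ⟩
  sumℤ (map g (map (false ∷_) V)) + sumℤ (map g (map (true ∷_) V))
    ≡⟨ cong₂ _+_ (cong sumℤ (sym (List.map-∘ V))) (cong sumℤ (sym (List.map-∘ V))) ⟩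
  (∑[ x ∈ V ] g (false ∷ x)) + (∑[ x ∈ V ] g (true ∷ x)) ∎
  where
  open ≡-Reasoning
  V = allVec n

-- The Walsh transform

-- 2ⁿ f̂(a): fourier f a is walsh f a / 2 ^ n by definition.
walsh : ∀ {n} → (F₂^ n → ℤ) → F₂^ n → ℤ
walsh {n} f a = ∑[ x ∈ allVec n ] f x * χ a x

walsh-∷ : ∀ {n} (f : F₂^ (suc n) → ℤ) b (a : F₂^ n) →
          walsh f (b ∷ a) ≡ walsh (f ∘ (false ∷_)) a + sgn b * walsh (f ∘ (true ∷_)) a
walsh-∷ {n} f b a = begin
  walsh f (b ∷ a)
    ≡⟨ ∑-allVec-suc n (λ x → f x * χ (b ∷ a) x) ⟩
  (∑[ x ∈ V ] f (false ∷ x) * χ (b ∷ a) (false ∷ x)) + (∑[ x ∈ V ] f (true ∷ x) * χ (b ∷ a) (true ∷ x))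
    ≡⟨ cong₂ _+_ (∑-cong V (λ x → cong (f (false ∷ x) *_) (χ-∷-false b a x)))
                 (∑-cong V (λ x → trans (cong (f (true ∷ x) *_) (χ-∷-true b a x))
                                        (swap (f (true ∷ x)) (sgn b) (χ a x)))) ⟩
  walsh (f ∘ (false ∷_)) a + (∑[ x ∈ V ] sgn b * (f (true ∷ x) * χ a x))
    ≡⟨ cong (_+_ (walsh (f ∘ (false ∷_)) a)) (∑-*ˡ V (sgn b) (λ x → f (true ∷ x) * χ a x)) ⟩
  walsh (f ∘ (false ∷_)) a + sgn b * walsh (f ∘ (true ∷_)) a ∎
  where
  open ≡-Reasoning
  V = allVec n
  swap : ∀ p q r → p * (q * r) ≡ q * (p * r)
  swap = solve-∀

autocorrelation : ∀ n (f : F₂^ n → ℤ) (γ : F₂^ n) →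
  ∑[ a ∈ allVec n ] walsh f a * walsh f (a ⊕ γ) ≡ + (2 ^ n) * walsh (λ x → f x * f x) γ
autocorrelation zero f [] = base (f [])
  where
  base : ∀ y → (y * + 1 + 0ℤ) * (y * + 1 + 0ℤ) + 0ℤ ≡ + 1 * (y * y * + 1 + 0ℤ)
  base = solve-∀
autocorrelation (suc n) f (c ∷ γ) = begin
  ∑[ a ∈ allVec (suc n) ] walsh f a * walsh f (a ⊕ (c ∷ γ))
    ≡⟨ ∑-allVec-suc n (λ a → walsh f a * walsh f (a ⊕ (c ∷ γ))) ⟩
  (∑[ a ∈ V ] walsh f (false ∷ a) * walsh f (c ∷ (a ⊕ γ)))
    + (∑[ a ∈ V ] walsh f (true ∷ a) * walsh f (not c ∷ (a ⊕ γ)))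
    ≡⟨ sym (∑-+ V _ _) ⟩
  ∑[ a ∈ V ] walsh f (false ∷ a) * walsh f (c ∷ (a ⊕ γ)) + walsh f (true ∷ a) * walsh f (not c ∷ (a ⊕ γ))
    ≡⟨ ∑-cong V split ⟩
  ∑[ a ∈ V ] + 2 * C f₀ a + (+ 2 * sgn c) * C f₁ a
    ≡⟨ trans (∑-+ V _ _) (cong₂ _+_ (∑-*ˡ V (+ 2) (C f₀)) (∑-*ˡ V (+ 2 * sgn c) (C f₁))) ⟩
  + 2 * ∑ V (C f₀) + (+ 2 * sgn c) * ∑ V (C f₁)
    ≡⟨ cong₂ (λ u v → + 2 * u + (+ 2 * sgn c) * v) (autocorrelation n f₀ γ) (autocorrelation n f₁ γ) ⟩
  + 2 * (+ (2 ^ n) * walsh (sq f₀) γ) + (+ 2 * sgn c) * (+ (2 ^ n) * walsh (sq f₁) γ)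
    ≡⟨ collect (+ (2 ^ n)) (sgn c) (walsh (sq f₀) γ) (walsh (sq f₁) γ) ⟩
  + 2 * + (2 ^ n) * (walsh (sq f₀) γ + sgn c * walsh (sq f₁) γ)
    ≡⟨ cong₂ _*_ (sym (ℤ.pos-* 2 (2 ^ n))) (sym (walsh-∷ (sq f) c γ)) ⟩
  + (2 ^ suc n) * walsh (sq f) (c ∷ γ) ∎
  where
  open ≡-Reasoning
  V = allVec n
  f₀ f₁ : F₂^ n → ℤ
  f₀ = f ∘ (false ∷_)
  f₁ = f ∘ (true ∷_)
  sq : ∀ {m} → (F₂^ m → ℤ) → F₂^ m → ℤ
  sq g x = g x * g x
  C : (F₂^ n → ℤ) → F₂^ n → ℤ
  C g a = walsh g a * walsh g (a ⊕ γ)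
  expand : ∀ A B A′ B′ s → (A + + 1 * B) * (A′ + s * B′) + (A + - + 1 * B) * (A′ + - s * B′)
                           ≡ + 2 * (A * A′) + (+ 2 * s) * (B * B′)
  expand = solve-∀
  collect : ∀ p s x y → + 2 * (p * x) + (+ 2 * s) * (p * y) ≡ + 2 * p * (x + s * y)
  collect = solve-∀
  split : ∀ a → walsh f (false ∷ a) * walsh f (c ∷ (a ⊕ γ)) + walsh f (true ∷ a) * walsh f (not c ∷ (a ⊕ γ))
                ≡ + 2 * C f₀ a + (+ 2 * sgn c) * C f₁ a
  split a rewrite walsh-∷ f false a | walsh-∷ f true a | walsh-∷ f c (a ⊕ γ)
                | walsh-∷ f (not c) (a ⊕ γ) | sgn-not c =
    expand (walsh f₀ a) (walsh f₁ a) (walsh f₀ (a ⊕ γ)) (walsh f₁ (a ⊕ γ)) (sgn c)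

walsh-one : ∀ n (γ : F₂^ n) → γ ≢ 𝟎 → walsh (λ _ → + 1) γ ≡ 0ℤ
walsh-one zero    []          γ≢𝟎 = ⊥-elim (γ≢𝟎 refl)
walsh-one (suc n) (false ∷ γ) γ≢𝟎 =
  trans (walsh-∷ (λ _ → + 1) false γ) (cong (λ w → w + + 1 * w) (walsh-one n γ (γ≢𝟎 ∘ cong (false ∷_))))
walsh-one (suc n) (true ∷ γ)  _   =
  trans (walsh-∷ (λ _ → + 1) true γ) (cancel (walsh (λ _ → + 1) γ))
  where
  cancel : ∀ w → w + - + 1 * w ≡ 0ℤ
  cancel = solve-∀

IsBoolean : ∀ {n} → (F₂^ n → ℤ) → Set
IsBoolean f = ∀ x → f x ≡ + 1 ⊎ f x ≡ -[1+ 0 ]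

autocorrelation-boolean : ∀ n (f : F₂^ n → ℤ) → IsBoolean f → (γ : F₂^ n) → γ ≢ 𝟎 →
  ∑[ a ∈ allVec n ] walsh f a * walsh f (a ⊕ γ) ≡ 0ℤ
autocorrelation-boolean n f boolean γ γ≢𝟎 = begin
  ∑[ a ∈ allVec n ] walsh f a * walsh f (a ⊕ γ)       ≡⟨ autocorrelation n f γ ⟩
  + (2 ^ n) * walsh (λ x → f x * f x) γ                ≡⟨ cong (+ (2 ^ n) *_) (∑-cong (allVec n) square≡1) ⟩
  + (2 ^ n) * walsh (λ _ → + 1) γ                      ≡⟨ cong (+ (2 ^ n) *_) (walsh-one n γ γ≢𝟎) ⟩
  + (2 ^ n) * 0ℤ                                       ≡⟨ ℤ.*-zeroʳ (+ (2 ^ n)) ⟩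
  0ℤ                                                   ∎
  where
  open ≡-Reasoning
  square≡1 : ∀ x → f x * f x * χ γ x ≡ + 1 * χ γ x
  square≡1 x with f x | boolean x
  ... | _ | inj₁ refl = refl
  ... | _ | inj₂ refl = refl

allVec-complete : ∀ n (v : F₂^ n) → v ∈ allVec n
allVec-complete zero    []          = here refl
allVec-complete (suc n) (false ∷ v) = ∈-++⁺ˡ (∈-map⁺ (false ∷_) (allVec-complete n v))
allVec-complete (suc n) (true ∷ v)  = ∈-++⁺ʳ (map (false ∷_) (allVec n)) (∈-map⁺ (true ∷_) (allVec-complete n v))

allVec-unique : ∀ n → Unique (allVec n)
allVec-unique zero    = All.[] AllPairs.∷ AllPairs.[]
allVec-unique (suc n) = Unique.++⁺ (Unique.map⁺ ∷-injectiveʳ (allVec-unique n))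
                                   (Unique.map⁺ ∷-injectiveʳ (allVec-unique n)) heads-differ
  where
  heads-differ : ∀ {v} → ¬ (v ∈ map (false ∷_) (allVec n) × v ∈ map (true ∷_) (allVec n))
  heads-differ (p , q) with ∈-map⁻ (false ∷_) p | ∈-map⁻ (true ∷_) q
  ... | _ , _ , refl | _ , _ , ()

0<+[1+] : ∀ {m} → 0ℤ < +[1+ m ]
0<+[1+] = ℤ.+<+ (ℕ.s≤s ℕ.z≤n)

i+i≡0⇒i≡0 : ∀ i → i + i ≡ 0ℤ → i ≡ 0ℤ
i+i≡0⇒i≡0 (+ zero)  _ = refl
i+i≡0⇒i≡0 +[1+ _ ]  ()
i+i≡0⇒i≡0 -[1+ _ ]  ()

i+j≡0⇒j<0 : ∀ i j → i + j ≡ 0ℤ → 0ℤ < i → j < 0ℤ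
i+j≡0⇒j<0 +[1+ _ ] (+ _)    ()
i+j≡0⇒j<0 +[1+ _ ] -[1+ _ ] _ _ = ℤ.-<+
i+j≡0⇒j<0 (+ zero) _        _ (ℤ.+<+ ())

*-≢0 : ∀ {i j} → i ≢ 0ℤ → j ≢ 0ℤ → i * j ≢ 0ℤ
*-≢0 {i} i≢0 j≢0 eq = [ i≢0 , j≢0 ] (ℤ.i*j≡0⇒i≡0∨j≡0 i eq)

*-≢0⁻ˡ : ∀ {i} j → i * j ≢ 0ℤ → i ≢ 0ℤ
*-≢0⁻ˡ j ne refl = ne (ℤ.*-zeroˡ j)

*-≢0⁻ʳ : ∀ i {j} → i * j ≢ 0ℤ → j ≢ 0ℤ
*-≢0⁻ʳ i ne refl = ne (ℤ.*-zeroʳ i)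

0<⇒≢0 : ∀ {i} → 0ℤ < i → i ≢ 0ℤ
0<⇒≢0 lt = ≢-sym (ℤ.<⇒≢ lt)

<0⇒≢0 : ∀ {i} → i < 0ℤ → i ≢ 0ℤ
<0⇒≢0 = ℤ.<⇒≢

*-self-pos : ∀ i → i ≢ 0ℤ → 0ℤ < i * i
*-self-pos (+ zero)  i≢0 = ⊥-elim (i≢0 refl)
*-self-pos +[1+ m ]  _   = 0<+[1+]
*-self-pos -[1+ m ]  _   = 0<+[1+]

pos-*-pos : ∀ i j → 0ℤ < i → 0ℤ < j → 0ℤ < i * j
pos-*-pos +[1+ _ ] +[1+ _ ] _ _ = 0<+[1+]
pos-*-pos (+ zero) _ (ℤ.+<+ ()) _
pos-*-pos +[1+ _ ] (+ zero) _ (ℤ.+<+ ())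

neg-*-neg : ∀ i j → i < 0ℤ → j < 0ℤ → 0ℤ < i * j
neg-*-neg -[1+ _ ] -[1+ _ ] _ _ = 0<+[1+]
neg-*-neg (+ _)    _ (ℤ.+<+ ()) _
neg-*-neg -[1+ _ ] (+ _) _ (ℤ.+<+ ())

pos-*⁻ : ∀ i j → 0ℤ < i → 0ℤ < i * j → 0ℤ < j
pos-*⁻ +[1+ _ ] +[1+ _ ] _ _  = 0<+[1+]
pos-*⁻ +[1+ m ] (+ zero) _ lt = ⊥-elim (0<⇒≢0 lt (ℤ.*-zeroʳ +[1+ m ]))
pos-*⁻ +[1+ _ ] -[1+ _ ] _ ()
pos-*⁻ (+ zero) _ (ℤ.+<+ ()) _

neg-*⁻ : ∀ i j → i < 0ℤ → 0ℤ < i * j → j < 0ℤ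
neg-*⁻ -[1+ _ ] -[1+ _ ] _ _  = ℤ.-<+
neg-*⁻ -[1+ m ] (+ zero) _ lt = ⊥-elim (0<⇒≢0 lt (ℤ.*-zeroʳ -[1+ m ]))
neg-*⁻ -[1+ _ ] +[1+ _ ] _ ()
neg-*⁻ (+ _) _ (ℤ.+<+ ()) _

same-sign-trans : ∀ i j k → 0ℤ < i * j → 0ℤ < i * k → 0ℤ < j * k
same-sign-trans i@(+[1+ _ ]) j k ij ik = pos-*-pos j k (pos-*⁻ i j 0<+[1+] ij) (pos-*⁻ i k 0<+[1+] ik)
same-sign-trans i@(-[1+ _ ]) j k ij ik = neg-*-neg j k (neg-*⁻ i j ℤ.-<+ ij) (neg-*⁻ i k ℤ.-<+ ik)
same-sign-trans (+ zero) j k (ℤ.+<+ ()) _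

opposite-signs : ∀ i j k → i ≢ 0ℤ → j * k < 0ℤ → 0ℤ < i * j ⊎ 0ℤ < i * k
opposite-signs (+ zero) _        _        i≢0 _ = ⊥-elim (i≢0 refl)
opposite-signs _        (+ zero) _        _   (ℤ.+<+ ())
opposite-signs _        j        (+ zero) _   jk<0 = ⊥-elim (<0⇒≢0 jk<0 (ℤ.*-zeroʳ j))
opposite-signs +[1+ _ ] +[1+ _ ] _        _   _ = inj₁ 0<+[1+]
opposite-signs -[1+ _ ] -[1+ _ ] _        _   _ = inj₁ 0<+[1+]
opposite-signs +[1+ _ ] -[1+ _ ] +[1+ _ ] _   _ = inj₂ 0<+[1+]
opposite-signs -[1+ _ ] +[1+ _ ] -[1+ _ ] _   _ = inj₂ 0<+[1+]
opposite-signs _        +[1+ _ ] +[1+ _ ] _   (ℤ.+<+ ())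
opposite-signs _        -[1+ _ ] -[1+ _ ] _   (ℤ.+<+ ())

module _ (d : ℕ) .{{_ : ℕ.NonZero d}} where

  0</ : ∀ m → 0ℚ ℚ.< +[1+ m ] / d
  0</ m = ℚ.positive⁻¹ _ {{ℚ.normalize-pos (suc m) d}}

  /<0 : ∀ m → -[1+ m ] / d ℚ.< 0ℚ
  /<0 m = ℚ.negative⁻¹ _ {{ℚ.neg-pos {ℚ.normalize (suc m) d} (ℚ.normalize-pos (suc m) d)}}

  /≡0⇒≡0 : ∀ i → i / d ≡ 0ℚ → i ≡ 0ℤ
  /≡0⇒≡0 (+ zero)  _  = refl
  /≡0⇒≡0 +[1+ m ]  eq = ⊥-elim (ℚ.<⇒≢ (0</ m) (sym eq))
  /≡0⇒≡0 -[1+ m ]  eq = ⊥-elim (ℚ.<⇒≢ (/<0 m) eq)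

  0</⇒0< : ∀ i → 0ℚ ℚ.< i / d → 0ℤ < i
  0</⇒0< (+ zero)  lt = ⊥-elim (ℚ.<-irrefl (sym (ℚ.0/n≡0 d)) lt)
  0</⇒0< +[1+ m ]  _  = 0<+[1+]
  0</⇒0< -[1+ m ]  lt = ⊥-elim (ℚ.<-asym lt (/<0 m))

  /<0⇒<0 : ∀ i → i / d ℚ.< 0ℚ → i < 0ℤ
  /<0⇒<0 (+ zero)  lt = ⊥-elim (ℚ.<-irrefl (ℚ.0/n≡0 d) lt)
  /<0⇒<0 +[1+ m ]  lt = ⊥-elim (ℚ.<-asym lt (0</ m))
  /<0⇒<0 -[1+ m ]  _  = ℤ.-<+

  0<⇒0</ : ∀ i → 0ℤ < i → 0ℚ ℚ.< i / d
  0<⇒0</ +[1+ m ] _ = 0</ m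
  0<⇒0</ (+ zero) (ℤ.+<+ ())

  <0⇒/<0 : ∀ i → i < 0ℤ → i / d ℚ.< 0ℚ
  <0⇒/<0 -[1+ m ] _ = /<0 m
  <0⇒/<0 (+ _)    (ℤ.+<+ ())

module _ {n : ℕ} (f : F₂^ n → ℤ) where
  private
    instance
      2^n≢0 : ℕ.NonZero (2 ^ n)
      2^n≢0 = m^n≢0 2 n

  ∈-supp⁻ : ∀ {a} → a ∈ supp f → walsh f a ≢ 0ℤ
  ∈-supp⁻ a∈ eq = proj₂ (∈-filter⁻ (λ a → ¬? (fourier f a ℚ.≟ 0ℚ)) {xs = allVec n} a∈)
                        (trans (cong (_/ 2 ^ n) eq) (ℚ.0/n≡0 (2 ^ n)))

  ∈-supp⁺ : ∀ {a} → walsh f a ≢ 0ℤ → a ∈ supp f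
  ∈-supp⁺ {a} ne = ∈-filter⁺ (λ a → ¬? (fourier f a ℚ.≟ 0ℚ)) (allVec-complete n a) (ne ∘ /≡0⇒≡0 (2 ^ n) _)

  ∈-supp₊⁻ : ∀ {a} → a ∈ supp₊ f → 0ℤ < walsh f a
  ∈-supp₊⁻ a∈ = 0</⇒0< (2 ^ n) _ (proj₂ (∈-filter⁻ (λ a → 0ℚ ℚ.<? fourier f a) {xs = allVec n} a∈))

  ∈-supp₊⁺ : ∀ {a} → 0ℤ < walsh f a → a ∈ supp₊ f
  ∈-supp₊⁺ {a} pos = ∈-filter⁺ (λ a → 0ℚ ℚ.<? fourier f a) (allVec-complete n a) (0<⇒0</ (2 ^ n) _ pos)

  ∈-supp₋⁻ : ∀ {a} → a ∈ supp₋ f → walsh f a < 0ℤ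
  ∈-supp₋⁻ a∈ = /<0⇒<0 (2 ^ n) _ (proj₂ (∈-filter⁻ (λ a → fourier f a ℚ.<? 0ℚ) {xs = allVec n} a∈))

  ∈-supp₋⁺ : ∀ {a} → walsh f a < 0ℤ → a ∈ supp₋ f
  ∈-supp₋⁺ {a} neg = ∈-filter⁺ (λ a → fourier f a ℚ.<? 0ℚ) (allVec-complete n a) (<0⇒/<0 (2 ^ n) _ neg)

  supp₊-unique : Unique (supp₊ f)
  supp₊-unique = Unique.filter⁺ (λ a → 0ℚ ℚ.<? fourier f a) (allVec-unique n)

  supp₋-unique : Unique (supp₋ f)
  supp₋-unique = Unique.filter⁺ (λ a → fourier f a ℚ.<? 0ℚ) (allVec-unique n)

length≡2⇒ : ∀ {A : Set} (xs : List A) → length xs ≡ 2 → ∃[ p ] ∃[ q ] (∀ {P : A → Set} → Any P xs → P p ⊎ P q)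
length≡2⇒ (p ∷ q ∷ []) _ = p , q , λ { (here Pp) → inj₁ Pp ; (there (here Pq)) → inj₂ Pq }

module _ {A : Set} where

  HasPartners : (A → A → Set) → List A → Set
  HasPartners R L = ∀ {x} → x ∈ L → ∃[ y ] y ∈ L × R x y

  PartnersUnique : (A → A → Set) → List A → Set
  PartnersUnique R L = ∀ {x y z} → x ∈ L → y ∈ L → z ∈ L → R x y → R x z → y ≡ z

  pairs-∈⁺ : ∀ {p q} {xs : List A} → p ∈ xs → q ∈ xs → p ≢ q → (p , q) ∈ pairs xs ⊎ (q , p) ∈ pairs xs
  pairs-∈⁺ {xs = x ∷ xs} (here refl) (here refl) p≢q = ⊥-elim (p≢q refl)
  pairs-∈⁺ {xs = x ∷ xs} (here refl) (there q∈) _ = inj₁ (∈-++⁺ˡ (∈-map⁺ (x ,_) q∈))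
  pairs-∈⁺ {xs = x ∷ xs} (there p∈) (here refl) _ = inj₂ (∈-++⁺ˡ (∈-map⁺ (x ,_) p∈))
  pairs-∈⁺ {xs = x ∷ xs} (there p∈) (there q∈) p≢q =
    Sum.map (∈-++⁺ʳ (map (x ,_) xs)) (∈-++⁺ʳ (map (x ,_) xs)) (pairs-∈⁺ p∈ q∈ p≢q)

module _ {A : Set} (_≟_ : DecidableEquality A) where

  private
    erase : A → (A → ℤ) → A → ℤ
    erase w g a with a ≟ w
    ... | yes _ = 0ℤ
    ... | no  _ = g a

    erase-≡ : ∀ w g → erase w g w ≡ 0ℤ
    erase-≡ w g with w ≟ w
    ... | yes _  = refl
    ... | no w≢w = ⊥-elim (w≢w refl)

    erase-≢ : ∀ {w a} g → a ≢ w → erase w g a ≡ g a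
    erase-≢ {w} {a} g a≢w with a ≟ w
    ... | yes a≡w = ⊥-elim (a≢w a≡w)
    ... | no  _   = refl

    ∑-erase : ∀ (V : List A) → Unique V → ∀ {w} → w ∈ V → (g : A → ℤ) → ∑ V g ≡ g w + ∑ V (erase w g)
    ∑-erase (v ∷ V) (v∉V AllPairs.∷ _) (here refl) g = cong (_+_ (g v)) (begin
      ∑ V g                   ≡⟨ ∑-cong-∈ V (λ x∈V → sym (erase-≢ g (≢-sym (All.lookup v∉V x∈V)))) ⟩
      ∑ V (erase v g)         ≡⟨ sym (ℤ.+-identityˡ _) ⟩
      0ℤ + ∑ V (erase v g)    ≡⟨ cong (_+ ∑ V (erase v g)) (sym (erase-≡ v g)) ⟩
      erase v g v + ∑ V (erase v g) ∎)
      where open ≡-Reasoning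
    ∑-erase (v ∷ V) (v∉V AllPairs.∷ uV) {w} (there w∈V) g = begin
      g v + ∑ V g                           ≡⟨ cong (_+_ (g v)) (∑-erase V uV w∈V g) ⟩
      g v + (g w + ∑ V (erase w g))         ≡⟨ exchange (g v) (g w) _ ⟩
      g w + (g v + ∑ V (erase w g))
        ≡⟨ cong (λ e → g w + (e + ∑ V (erase w g))) (sym (erase-≢ g (All.lookup v∉V w∈V))) ⟩
      g w + (erase w g v + ∑ V (erase w g)) ∎
      where
      open ≡-Reasoning
      exchange : ∀ a b c → a + (b + c) ≡ b + (a + c)
      exchange = solve-∀

  ∑-support : ∀ (V : List A) → Unique V → (∀ a → a ∈ V) → (W : List A) → Unique W →
              (g : A → ℤ) → (∀ a → g a ≢ 0ℤ → a ∈ W) → ∑ V g ≡ ∑ W g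
  ∑-support V uV complete [] uW g support = ∑-zero V vanishes
    where
    vanishes : ∀ a → g a ≡ 0ℤ
    vanishes a with g a ℤ.≟ 0ℤ
    ... | yes ga≡0 = ga≡0
    ... | no  ga≢0 with () ← support a ga≢0
  ∑-support V uV complete (w ∷ W) (w∉W AllPairs.∷ uW) g support = begin
    ∑ V g                 ≡⟨ ∑-erase V uV (complete w) g ⟩
    g w + ∑ V (erase w g) ≡⟨ cong (_+_ (g w)) (∑-support V uV complete W uW (erase w g) support′) ⟩
    g w + ∑ W (erase w g) ≡⟨ cong (_+_ (g w)) (∑-cong-∈ W (λ a∈W → erase-≢ g (≢-sym (All.lookup w∉W a∈W)))) ⟩
    g w + ∑ W g           ∎
    where
    open ≡-Reasoning
    support′ : ∀ a → erase w g a ≢ 0ℤ → a ∈ W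
    support′ a ne with a ≟ w
    ... | yes _   = ⊥-elim (ne refl)
    ... | no  a≢w with support a ne
    ...   | here a≡w  = ⊥-elim (a≢w a≡w)
    ...   | there a∈W = a∈W

  remove : A → List A → List A
  remove y = filter (λ x → ¬? (x ≟ y))

  ∈-remove⁻ : ∀ {x y} xs → x ∈ remove y xs → x ∈ xs × x ≢ y
  ∈-remove⁻ {y = y} xs = ∈-filter⁻ (λ x → ¬? (x ≟ y)) {xs = xs}

  ∈-remove⁺ : ∀ {x y xs} → x ∈ xs → x ≢ y → x ∈ remove y xs
  ∈-remove⁺ {y = y} = ∈-filter⁺ (λ x → ¬? (x ≟ y))

  remove-unique : ∀ {xs} y → Unique xs → Unique (remove y xs)
  remove-unique y = Unique.filter⁺ (λ x → ¬? (x ≟ y))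

  length-remove : ∀ {y} xs → Unique xs → y ∈ xs → length xs ≡ suc (length (remove y xs))
  length-remove (x ∷ xs) (x∉xs AllPairs.∷ _) (here refl) = cong suc (cong length (begin
    xs                                ≡⟨ sym (List.filter-all (λ z → ¬? (z ≟ x)) (All.map ≢-sym x∉xs)) ⟩
    remove x xs                       ≡⟨ sym (List.filter-reject (λ z → ¬? (z ≟ x)) (λ x≢x → x≢x refl)) ⟩
    remove x (x ∷ xs)                 ∎))
    where open ≡-Reasoning
  length-remove {y} (x ∷ xs) (x∉xs AllPairs.∷ uxs) (there y∈xs) = cong suc (begin
    length xs                         ≡⟨ length-remove xs uxs y∈xs ⟩
    suc (length (remove y xs))        ≡⟨ cong length (sym (List.filter-accept (λ z → ¬? (z ≟ y)) (All.lookup x∉xs y∈xs))) ⟩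
    length (remove y (x ∷ xs))        ∎)
    where open ≡-Reasoning

  matching⇒even : ∀ {R : A → A → Set} → (∀ {x y} → R x y → R y x) → (∀ {x} → ¬ R x x) →
                  ∀ L → Unique L → HasPartners R L → PartnersUnique R L → ∃[ m ] length L ≡ m ℕ.* 2
  matching⇒even {R} R-sym R-irrefl L = go (length L) L ℕ.≤-refl
    where
    go : ∀ k L → length L ℕ.≤ k → Unique L → HasPartners R L → PartnersUnique R L → ∃[ m ] length L ≡ m ℕ.* 2
    go _       []       _          _                      _   _      = 0 , refl
    go (suc k) (x ∷ ys) (ℕ.s≤s ≤k) (x∉ys AllPairs.∷ uys) has unique with has (here refl)
    ... | _ , here refl    , Rxx = ⊥-elim (R-irrefl Rxx)
    ... | y , there y∈ys , Rxy =
      let m , eq = go k zs shorter (remove-unique y uys) has′ (λ a b c → unique (sub a) (sub b) (sub c))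
      in suc m , cong suc (trans (length-remove ys uys y∈ys) (cong suc eq))
      where
      zs = remove y ys
      shorter : length zs ℕ.≤ k
      shorter = ℕ.≤-trans (ℕ.n≤1+n _) (subst (ℕ._≤ k) (length-remove ys uys y∈ys) ≤k)
      sub : ∀ {z} → z ∈ zs → z ∈ x ∷ ys
      sub = there ∘ proj₁ ∘ ∈-remove⁻ ys
      has′ : HasPartners R zs
      has′ z∈zs with ∈-remove⁻ ys z∈zs | has (sub z∈zs)
      ... | z∈ys , z≢y | w , w∈L , Rzw = w , ∈-remove⁺ (tail w≢x w∈L) w≢y , Rzw
        where
        w≢x : w ≢ x
        w≢x refl = z≢y (unique (here refl) (sub z∈zs) (there y∈ys) (R-sym Rzw) Rxy)
        w≢y : w ≢ y
        w≢y refl = All.lookup x∉ys z∈ys (unique (there y∈ys) (here refl) (sub z∈zs) (R-sym Rxy) (R-sym Rzw))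

-- Cosets of {𝟎, γ}

_≟ᵥ_ : ∀ {n} → DecidableEquality (F₂^ n)
_≟ᵥ_ = Vec.≡-dec Bool._≟_

module Cosets {n : ℕ} (γ : F₂^ n) where

  infix 4 _~_
  _~_ : F₂^ n → F₂^ n → Set
  a ~ b = a ≡ b ⊎ a ≡ b ⊕ γ

  ~-sym : ∀ {a b} → a ~ b → b ~ a
  ~-sym (inj₁ refl) = inj₁ refl
  ~-sym {b = b} (inj₂ refl) = inj₂ (sym (⊕-cancelʳ b γ))

  ~-trans : ∀ {a b c} → a ~ b → b ~ c → a ~ c
  ~-trans (inj₁ refl) b~c                 = b~c
  ~-trans (inj₂ refl) (inj₁ refl)         = inj₂ refl
  ~-trans (inj₂ refl) (inj₂ refl)         = inj₁ (⊕-cancelʳ _ γ)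

  ~-invariant : (h : F₂^ n → ℤ) → (∀ a → h (a ⊕ γ) ≡ h a) → ∀ {a b} → a ~ b → h a ≡ h b
  ~-invariant h inv (inj₁ refl) = refl
  ~-invariant h inv (inj₂ refl) = inv _

  module _ (γ≢𝟎 : γ ≢ 𝟎) (h : F₂^ n → ℤ) (h-invariant : ∀ a → h (a ⊕ γ) ≡ h a) where

    private
      ~⇒∈ : ∀ {a u} → a ~ u → a ∈ u ∷ u ⊕ γ ∷ []
      ~⇒∈ (inj₁ a≡u)   = here a≡u
      ~⇒∈ (inj₂ a≡u⊕γ) = there (here a≡u⊕γ)

      ∑-support-allVec : ∀ W → Unique W → (∀ a → h a ≢ 0ℤ → a ∈ W) → ∑ (allVec n) h ≡ ∑ W h
      ∑-support-allVec W uW = ∑-support _≟ᵥ_ (allVec n) (allVec-unique n) (allVec-complete n) W uW h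

    ∑-one-coset : ∀ u → (∀ a → h a ≢ 0ℤ → a ~ u) → ∑ (allVec n) h ≡ h u + h u
    ∑-one-coset u support = begin
      ∑ (allVec n) h              ≡⟨ ∑-support-allVec (u ∷ u ⊕ γ ∷ []) unique (λ a → ~⇒∈ ∘ support a) ⟩
      h u + (h (u ⊕ γ) + 0ℤ)      ≡⟨ cong (λ x → h u + x) (trans (ℤ.+-identityʳ _) (h-invariant u)) ⟩
      h u + h u                   ∎
      where
      open ≡-Reasoning
      unique : Unique (u ∷ u ⊕ γ ∷ [])
      unique = (a≢a⊕b γ≢𝟎 u All.∷ All.[]) AllPairs.∷ All.[] AllPairs.∷ AllPairs.[]

    ∑-two-cosets : ∀ u v → ¬ u ~ v → (∀ a → h a ≢ 0ℤ → a ~ u ⊎ a ~ v) →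
                   ∑ (allVec n) h ≡ (h u + h u) + (h v + h v)
    ∑-two-cosets u v u≁v support = begin
      ∑ (allVec n) h
        ≡⟨ ∑-support-allVec (u ∷ u ⊕ γ ∷ v ∷ v ⊕ γ ∷ []) unique
             (λ a → [ ∈-++⁺ˡ ∘ ~⇒∈ , ∈-++⁺ʳ (u ∷ u ⊕ γ ∷ []) ∘ ~⇒∈ ] ∘ support a) ⟩
      h u + (h (u ⊕ γ) + (h v + (h (v ⊕ γ) + 0ℤ)))
        ≡⟨ cong₂ (λ x y → h u + (x + (h v + (y + 0ℤ)))) (h-invariant u) (h-invariant v) ⟩
      h u + (h u + (h v + (h v + 0ℤ)))
        ≡⟨ regroup (h u) (h v) ⟩
      (h u + h u) + (h v + h v) ∎
      where
      open ≡-Reasoning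
      regroup : ∀ x y → x + (x + (y + (y + 0ℤ))) ≡ (x + x) + (y + y)
      regroup = solve-∀
      unique : Unique (u ∷ u ⊕ γ ∷ v ∷ v ⊕ γ ∷ [])
      unique = (a≢a⊕b γ≢𝟎 u All.∷ (u≁v ∘ inj₁) All.∷ (u≁v ∘ inj₂) All.∷ All.[])
        AllPairs.∷ ((λ u⊕γ≡v → u≁v (~-sym (inj₂ (sym u⊕γ≡v))))
                    All.∷ (u≁v ∘ inj₁ ∘ ⊕-injectiveʳ γ) All.∷ All.[])
        AllPairs.∷ (a≢a⊕b γ≢𝟎 v All.∷ All.[])
        AllPairs.∷ All.[] AllPairs.∷ AllPairs.[]

-- The pairing of a sign class

module Correlation {n : ℕ} (f : F₂^ n → ℤ) (boolean : IsBoolean f) (γ : F₂^ n) where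

  open Cosets γ

  private
    F : F₂^ n → ℤ
    F = walsh f

  π : F₂^ n → ℤ
  π a = F a * F (a ⊕ γ)

  π-invariant : ∀ a → π (a ⊕ γ) ≡ π a
  π-invariant a = trans (cong (F (a ⊕ γ) *_) (cong F (⊕-cancelʳ a γ))) (ℤ.*-comm (F (a ⊕ γ)) (F a))

  record SecondCoset (α : F₂^ n) : Set where
    field
      c        : F₂^ n
      c≁α      : ¬ c ~ α
      π-cancel : π α + π c ≡ 0ℤ
      cover    : ∀ a → π a ≢ 0ℤ → a ~ α ⊎ a ~ c

  ∈-O : ∀ {p} → p ∈ pairs (supp f) → proj₁ p ⊕ proj₂ p ≡ γ → p ∈ O f γ
  ∈-O = ∈-filter⁺ (λ p → (proj₁ p ⊕ proj₂ p) ≟ᵥ γ)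

  module _ (γ≢𝟎 : γ ≢ 𝟎) where

    ∑π≡0 : ∑ (allVec n) π ≡ 0ℤ
    ∑π≡0 = autocorrelation-boolean n f boolean γ γ≢𝟎

    private
      secondCoset′ : ∀ {α u v} → π α ≢ 0ℤ → α ~ u → (∀ a → π a ≢ 0ℤ → a ~ u ⊎ a ~ v) → SecondCoset α
      secondCoset′ {α} {u} {v} πα≢0 α~u cover = record
        { c = v ; c≁α = v≁α ; π-cancel = cancel ; cover = cover′ }
        where
        cover′ : ∀ a → π a ≢ 0ℤ → a ~ α ⊎ a ~ v
        cover′ a πa≢0 = Sum.map₁ (λ a~u → ~-trans a~u (~-sym α~u)) (cover a πa≢0)
        -- Otherwise π is supported on a single coset and the vanishing sum would be 2 π α.
        v≁α : ¬ v ~ α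
        v≁α v~α = πα≢0 (i+i≡0⇒i≡0 (π α) (trans (sym (∑-one-coset γ≢𝟎 π π-invariant α only-α)) ∑π≡0))
          where
          only-α : ∀ a → π a ≢ 0ℤ → a ~ α
          only-α a = [ id , (λ a~v → ~-trans a~v v~α) ] ∘ cover′ a
        cancel : π α + π v ≡ 0ℤ
        cancel = i+i≡0⇒i≡0 (π α + π v) (begin
          (π α + π v) + (π α + π v) ≡⟨ regroup (π α) (π v) ⟩
          (π α + π α) + (π v + π v) ≡⟨ sym (∑-two-cosets γ≢𝟎 π π-invariant α v (v≁α ∘ ~-sym) cover′) ⟩
          ∑ (allVec n) π            ≡⟨ ∑π≡0 ⟩
          0ℤ                        ∎)
          where
          open ≡-Reasoning
          regroup : ∀ x y → (x + y) + (x + y) ≡ (x + x) + (y + y)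
          regroup = solve-∀

    secondCoset : ∀ {α u v} → π α ≢ 0ℤ → (∀ a → π a ≢ 0ℤ → a ~ u ⊎ a ~ v) → SecondCoset α
    secondCoset {α} πα≢0 cover with cover α πα≢0
    ... | inj₁ α~u = secondCoset′ πα≢0 α~u cover
    ... | inj₂ α~v = secondCoset′ πα≢0 α~v (λ a → Sum.swap ∘ cover a)

    O-cover : ∀ a → π a ≢ 0ℤ → Any (λ p → a ~ proj₁ p) (O f γ)
    O-cover a πa≢0
      with pairs-∈⁺ (∈-supp⁺ f (*-≢0⁻ˡ (F (a ⊕ γ)) πa≢0)) (∈-supp⁺ f (*-≢0⁻ʳ (F a) πa≢0)) (a≢a⊕b γ≢𝟎 a)
    ... | inj₁ p∈ = Any.map (λ { refl → inj₁ refl }) (∈-O p∈ (⊕-cancelˡ a γ))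
    ... | inj₂ p∈ = Any.map (λ { refl → inj₂ (sym (⊕-cancelʳ a γ)) })
                            (∈-O p∈ (trans (⊕-comm (a ⊕ γ) a) (⊕-cancelˡ a γ)))

module _ {n : ℕ} (f : F₂^ n → ℤ) (boolean : IsBoolean f) (α : F₂^ n) (α∈S : α ∈ supp f)
         (two-pairs : ∀ β → β ∈ supp f → β ≢ α → length (O f (α ⊕ β)) ≡ 2) where

  private
    F : F₂^ n → ℤ
    F = walsh f

    Fα≢0 : F α ≢ 0ℤ
    Fα≢0 = ∈-supp⁻ f α∈S

  SameSign : F₂^ n → Set
  SameSign x = 0ℤ < F α * F x

  -- For y ∈ S ∖ {α, β}: {y, y ⊕ (α ⊕ β)} is a pair of O_{α⊕β} other than {α, β}.
  Partner : F₂^ n → F₂^ n → Set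
  Partner β y = β ≢ y × F (y ⊕ (α ⊕ β)) ≢ 0ℤ

  Partner-sym : ∀ {β y} → Partner β y → Partner y β
  Partner-sym {β} {y} (β≢y , ne) = ≢-sym β≢y , subst (λ x → F x ≢ 0ℤ) (⊕-swap y α β) ne

  Partner-irrefl : ∀ {β} → ¬ Partner β β
  Partner-irrefl (β≢β , _) = β≢β refl

  module _ {β : F₂^ n} (sβ : SameSign β) (β≢α : β ≢ α) where

    private
      γ : F₂^ n
      γ = α ⊕ β

      γ≢𝟎 : γ ≢ 𝟎
      γ≢𝟎 = β≢α ∘ sym ∘ ⊕≡𝟎⇒≡

      open Cosets γ
      open Correlation f boolean γ

      α⊕γ≡β : α ⊕ γ ≡ β
      α⊕γ≡β = ⊕-cancelˡ α β

      β~α : β ~ α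
      β~α = inj₂ (sym α⊕γ≡β)

      πα≡FαFβ : π α ≡ F α * F β
      πα≡FαFβ = cong (λ x → F α * F x) α⊕γ≡β

      structure : SecondCoset α
      structure with length≡2⇒ (O f γ) (two-pairs β (∈-supp⁺ f (*-≢0⁻ʳ (F α) (0<⇒≢0 sβ))) β≢α)
      ... | _ , _ , split = secondCoset γ≢𝟎
        (subst (_≢ 0ℤ) (sym πα≡FαFβ) (0<⇒≢0 sβ)) (λ a → split ∘ O-cover γ≢𝟎 a)

      open SecondCoset structure

      πc<0 : π c < 0ℤ
      πc<0 = i+j≡0⇒j<0 _ _ π-cancel (subst (0ℤ <_) (sym πα≡FαFβ) sβ)

      π-on-c-coset : ∀ {y} → y ~ c → π y ≡ π c
      π-on-c-coset = ~-invariant π π-invariant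

      partner-in-coset : ∀ {y} → y ~ c → SameSign y → ∃[ y′ ] SameSign y′ × y′ ≢ α × Partner β y′
      partner-in-coset {y} y~c sy = y , sy , y≁α ∘ inj₁ , β≢y , F[y⊕γ]≢0
        where
        y≁α : ¬ y ~ α
        y≁α y~α = c≁α (~-trans (~-sym y~c) y~α)
        β≢y : β ≢ y
        β≢y refl = y≁α β~α
        F[y⊕γ]≢0 : F (y ⊕ γ) ≢ 0ℤ
        F[y⊕γ]≢0 = *-≢0⁻ʳ (F y) (subst (_≢ 0ℤ) (sym (π-on-c-coset y~c)) (<0⇒≢0 πc<0))

      partner∈c-coset : ∀ {y} → SameSign y → y ≢ α → Partner β y → y ~ c
      partner∈c-coset {y} sy y≢α (β≢y , F[y⊕γ]≢0) with cover y (*-≢0 (*-≢0⁻ʳ (F α) (0<⇒≢0 sy)) F[y⊕γ]≢0)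
      ... | inj₁ (inj₁ y≡α)   = ⊥-elim (y≢α y≡α)
      ... | inj₁ (inj₂ y≡α⊕γ) = ⊥-elim (β≢y (sym (trans y≡α⊕γ α⊕γ≡β)))
      ... | inj₂ y~c          = y~c

    partner-exists : ∃[ y ] SameSign y × y ≢ α × Partner β y
    partner-exists with opposite-signs (F α) (F c) (F (c ⊕ γ)) Fα≢0 πc<0
    ... | inj₁ sc   = partner-in-coset (inj₁ refl) sc
    ... | inj₂ sc⊕γ = partner-in-coset (inj₂ refl) sc⊕γ

    partner-unique : ∀ {y z} → SameSign y → y ≢ α → Partner β y → SameSign z → z ≢ α → Partner β z → y ≡ z
    partner-unique {y} {z} sy y≢α βy sz z≢α βz
      with ~-trans (partner∈c-coset sy y≢α βy) (~-sym (partner∈c-coset sz z≢α βz))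
    ... | inj₁ y≡z   = y≡z
    ... | inj₂ y≡z⊕γ = ⊥-elim (ℤ.<-asym πc<0 (subst (0ℤ <_) FzFy≡πc (same-sign-trans (F α) (F z) (F y) sz sy)))
      where
      FzFy≡πc : F z * F y ≡ π c
      FzFy≡πc = trans (cong (λ x → F z * F x) y≡z⊕γ) (π-on-c-coset (partner∈c-coset sz z≢α βz))

  sign-class-odd : ∀ (L : List (F₂^ n)) → Unique L →
                   (∀ {x} → x ∈ L → SameSign x) → (∀ {x} → SameSign x → x ∈ L) → length L % 2 ≡ 1
  sign-class-odd L uL L⁻ L⁺ =
    odd (matching⇒even _≟ᵥ_ Partner-sym Partner-irrefl T (remove-unique _≟ᵥ_ α uL) has unique)
    where
    T = remove _≟ᵥ_ α L
    has : HasPartners Partner T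
    has {x} x∈T with ∈-remove⁻ _≟ᵥ_ L x∈T
    ... | x∈L , x≢α with partner-exists (L⁻ x∈L) x≢α
    ...   | y , sy , y≢α , Pxy = y , ∈-remove⁺ _≟ᵥ_ (L⁺ sy) y≢α , Pxy
    unique : PartnersUnique Partner T
    unique x∈T y∈T z∈T =
      let x∈L , x≢α = ∈-remove⁻ _≟ᵥ_ L x∈T
          y∈L , y≢α = ∈-remove⁻ _≟ᵥ_ L y∈T
          z∈L , z≢α = ∈-remove⁻ _≟ᵥ_ L z∈T
      in λ Pxy Pxz → partner-unique (L⁻ x∈L) x≢α (L⁻ y∈L) y≢α Pxy (L⁻ z∈L) z≢α Pxz
    odd : ∃[ m ] length T ≡ m ℕ.* 2 → length L % 2 ≡ 1
    odd (m , eq) = begin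
      length L % 2         ≡⟨ cong (_% 2) (length-remove _≟ᵥ_ L uL (L⁺ (*-self-pos (F α) Fα≢0))) ⟩
      suc (length T) % 2   ≡⟨ cong (λ k → suc k % 2) eq ⟩
      (1 ℕ.+ m ℕ.* 2) % 2  ≡⟨ [m+kn]%n≡m%n 1 m 2 ⟩
      1                    ∎
      where open ≡-Reasoning

claim3 : (n : ℕ) (f : F₂^ n → ℤ)
           → (∀ x → f x ≡ + 1 ⊎ f x ≡ -[1+ 0 ])
           → Σ (F₂^ n) (λ α → α ∈ supp f
               × (∀ β → β ∈ supp f → β ≢ α → length (O f (α ⊕ β)) ≡ 2))
           → (length (supp₊ f) % 2 ≡ 1) ⊎ (length (supp₋ f) % 2 ≡ 1)
claim3 n f boolean (α , α∈S , two-pairs) with ℤ.<-cmp (walsh f α) 0ℤ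
... | tri< Fα<0 _ _ = inj₂ (sign-class-odd f boolean α α∈S two-pairs (supp₋ f) (supp₋-unique f)
                              (neg-*-neg _ _ Fα<0 ∘ ∈-supp₋⁻ f) (∈-supp₋⁺ f ∘ neg-*⁻ _ _ Fα<0))
... | tri≈ _ Fα≡0 _ = ⊥-elim (∈-supp⁻ f α∈S Fα≡0)
... | tri> _ _ Fα>0 = inj₁ (sign-class-odd f boolean α α∈S two-pairs (supp₊ f) (supp₊-unique f)
                              (pos-*-pos _ _ Fα>0 ∘ ∈-supp₊⁻ f) (∈-supp₊⁺ f ∘ pos-*⁻ _ _ Fα>0))
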